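{- Let $G$ be an $n$-vertex graph whose vertex set is the disjoint union of $X$ and $Y$ with $2\le |X|\le |Y|$. Let $x\in X$ and $y\in Y$ be such that every $x'\in X\setminus\{x\}$ is adjacent to at least one vertex of every component of $G[Y]$ except the one containing $y$, and every $y'\in Y\setminus\{y\}$ is adjacent to at least one vertex of every component of $G[X]$ except the one containing $x$. Furthermore, assume that there exist $x'\in X\setminus\{x\}$ and a subgraph $F\subseteq G[X,Y]$ such that $d_F(x')\le 1$ and $|E(F)|\ge n-1$. Then $|E(G)|\ge 2n-7$.
   Context: $G[X]$ is the subgraph induced by $X$; $G[X,Y]$ is the graph on $X\cup Y$ whose edges are the edges of $G$ with one endpoint in $X$ and the other in $Y$. Components are vertex sets of connected components. $d_F(x')$ is the degree of $x'$ in $F$. -}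

module Defs where

open import Data.Nat using (ℕ; zero; suc; _+_; _<ᵇ_)
open import Data.Fin using (Fin; toℕ)
import Data.Fin as F
open import Data.Bool using (Bool; true; false; not; _∧_; if_then_else_)
open import Relation.Binary.PropositionalEquality using (_≡_)

record Graph (n : ℕ) : Set where
  field
    adj   : Fin n → Fin n → Bool
    sym   : ∀ u v → adj u v ≡ adj v u
    irrefl : ∀ u → adj u u ≡ false
open Graph public

countF : ∀ {n} → (Fin n → Bool) → ℕ
countF {zero}  p = 0
countF {suc n} p = (if p F.zero then 1 else 0) + countF (λ i → p (F.suc i))

sumF : ∀ {n} → (Fin n → ℕ) → ℕ
sumF {zero}  f = 0
sumF {suc n} f = f F.zero + sumF (λ i → f (F.suc i))

edgeCount : ∀ {n} → (Fin n → Fin n → Bool) → ℕ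
edgeCount r = sumF (λ i → countF (λ j → (toℕ i <ᵇ toℕ j) ∧ r i j))

degree : ∀ {n} → (Fin n → Fin n → Bool) → Fin n → ℕ
degree r v = countF (r v)

-- Walks in the induced subgraph G[S]: all vertices lie in S.
-- Two vertices of S are in the same component of G[S] iff there is such a walk.
data WalkIn {n : ℕ} (G : Graph n) (S : Fin n → Bool) : Fin n → Fin n → Set where
  here : ∀ {u} → S u ≡ true → WalkIn G S u u
  step : ∀ {u v w} → S u ≡ true → adj G u v ≡ true → WalkIn G S v w → WalkIn G S u w

-- F is a subgraph of the bipartite graph G[X,Y] (X = side true, Y = side false):
-- a symmetric relation whose edges are edges of G between X and Y.
record BipSub {n : ℕ} (G : Graph n) (side : Fin n → Bool) : Set where
  field
    fadj   : Fin n → Fin n → Bool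
    fsym   : ∀ u v → fadj u v ≡ fadj v u
    fsub   : ∀ u v → fadj u v ≡ true → adj G u v ≡ true
    fcross : ∀ u v → fadj u v ≡ true → side u ≡ not (side v)
open BipSub public

{-# OPTIONS --safe #-}
module Submission where

-- Write a = |X| and b = |Y|, so that n = a + b.  If G[X] has at least five components, every
-- y′ ∈ Y ∖ {y} has a neighbour in each of the four not containing x, so G has at least
-- 4(b − 1) ≥ 2n − 4 edges.  Otherwise G[X] has at most four components, hence at least
-- a − 4 edges.  Let y₀ be the F-neighbour of x′, if any.  In G − F every vertex of Y is joined
-- inside Y ∪ {x′} to y, to x′ or to y₀, so (G − F)[Y ∪ {x′}] has at most three components and
-- at least b − 2 edges.  These edges, those of G[X] and those of F are pairwise disjoint, so
-- |E(G)| ≥ (a − 4) + (b − 2) + (n − 1) = 2n − 7.  Components are only used classically, which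
-- is harmless because the conclusion is decidable.

open import Defs
open import Data.Nat using (ℕ; zero; suc; _+_; _<ᵇ_; _≤_; _<_; _*_; _∸_; z≤n; s≤s; _≤?_)
open import Data.Nat.Properties
  using (≤-refl; ≤-reflexive; ≤-trans; ≤-antisym; 1+n≰n; ≤⇒≯; m≤n⇒m≤1+n; <⇒<ᵇ; <-cmp;
         +-comm; +-suc; +-mono-≤; +-monoˡ-≤; +-monoʳ-≤; *-monoʳ-≤; *-zeroʳ; *-identityʳ;
         m≤n+m; m≤m+n; m≤n+o⇒m∸n≤o; m≤n+m∸n; +-*-semiring; module ≤-Reasoning)
open import Data.Fin using (Fin; zero; suc; toℕ)
open import Data.Fin.Properties using (_≟_; toℕ-injective) renaming (any? to anyFin?)
open import Data.Bool using (Bool; true; false; not; _∧_; _∨_; if_then_else_)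
open import Data.Bool.Properties using (∧-comm; ∧-zeroʳ; T-≡; not-¬) renaming (_≟_ to _≟ᴮ_)
open import Data.Product using (Σ; _×_; ∃; ∃₂; _,_; proj₁; proj₂)
open import Data.Sum using (_⊎_; inj₁; inj₂)
open import Data.Empty using (⊥; ⊥-elim)
open import Data.List using (List; []; _∷_; length)
open import Data.List.Membership.Propositional using (_∈_)
open import Data.List.Relation.Unary.All as All using (All; []; _∷_)
open import Data.List.Relation.Unary.AllPairs as AllPairs using (AllPairs; []; _∷_)
open import Data.List.Relation.Unary.Any using (here; there; any?)
open import Function using (_∘_; flip; Equivalence)
open import Relation.Binary using (tri<; tri≈; tri>)
open import Relation.Binary.PropositionalEquality
  using (_≡_; _≢_; refl; cong; cong₂; trans; subst; module ≡-Reasoning)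
import Relation.Binary.PropositionalEquality as ≡
open import Relation.Nullary using (¬_; Dec; yes; no; does; _×-dec_)
open import Relation.Nullary.Decidable using (dec-true; dec-false; decidable-stable)
open import Relation.Nullary.Negation using (¬¬-Monad)
open import Relation.Nullary.Decidable.Core using (¬¬-excluded-middle)
open import Effect.Monad using (RawMonad)
open import Level using (0ℓ)
open import Data.Nat.Tactic.RingSolver using (solve-∀)
open import Algebra.Properties.Semiring.Sum +-*-semiring
  using (sum; sum-syntax; sum-cong-≗; ∑-distrib-+; ∑-comm; *-distribˡ-sum)

open RawMonad (¬¬-Monad {0ℓ}) using (pure; _>>=_)

private variable
  n : ℕ

∧-true⁻ : ∀ {a b} → a ∧ b ≡ true → a ≡ true × b ≡ true
∧-true⁻ {true} {true} _ = refl , refl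

∧-true⁺ : ∀ {a b} → a ≡ true → b ≡ true → a ∧ b ≡ true
∧-true⁺ refl refl = refl

∨-true⁻ : ∀ {a b} → a ∨ b ≡ true → a ≡ true ⊎ b ≡ true
∨-true⁻ {true}  _ = inj₁ refl
∨-true⁻ {false} b≡true = inj₂ b≡true

∨-true⁺ˡ : ∀ {a b} → a ≡ true → a ∨ b ≡ true
∨-true⁺ˡ refl = refl

∨-true⁺ʳ : ∀ {a b} → b ≡ true → a ∨ b ≡ true
∨-true⁺ʳ {true}  _ = refl
∨-true⁺ʳ {false} b≡true = b≡true

not-true⁻ : ∀ {a} → not a ≡ true → a ≡ false
not-true⁻ {false} _ = refl

not-true⁺ : ∀ {a} → a ≡ false → not a ≡ true
not-true⁺ refl = refl

true≢false : ∀ {a} → a ≡ true → a ≡ false → ⊥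
true≢false refl ()

𝟙 : Bool → ℕ
𝟙 b = if b then 1 else 0

𝟙-mono : ∀ {a b} → (a ≡ true → b ≡ true) → 𝟙 a ≤ 𝟙 b
𝟙-mono {false} _ = z≤n
𝟙-mono {true} a⇒b rewrite a⇒b refl = ≤-refl

𝟙-+-≤ : ∀ {a b c} → (a ≡ true → b ≡ true → ⊥) → (a ≡ true → c ≡ true) → (b ≡ true → c ≡ true)
  → 𝟙 a + 𝟙 b ≤ 𝟙 c
𝟙-+-≤ {false} _ _ b⇒c = 𝟙-mono b⇒c
𝟙-+-≤ {true} {false} _ a⇒c _ = 𝟙-mono a⇒c
𝟙-+-≤ {true} {true} disjoint _ _ = ⊥-elim (disjoint refl refl)

𝟙-≤-+ : ∀ {a b c} → (c ≡ true → a ≡ true ⊎ b ≡ true) → 𝟙 c ≤ 𝟙 a + 𝟙 b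
𝟙-≤-+ {c = false} _ = z≤n
𝟙-≤-+ {a} {b} {true} c⇒a∨b with c⇒a∨b refl
... | inj₁ refl = s≤s z≤n
... | inj₂ refl = m≤n+m 1 (𝟙 a)

⁅_⁆ : Fin n → Fin n → Bool
⁅ a ⁆ v = does (v ≟ a)

infixl 6 _∪_ _∖_

_∪_ : (Fin n → Bool) → (Fin n → Bool) → Fin n → Bool
(p ∪ q) v = p v ∨ q v

_∖_ : (Fin n → Bool) → (Fin n → Bool) → Fin n → Bool
(p ∖ q) v = p v ∧ not (q v)

⁅⁆-refl : (a : Fin n) → ⁅ a ⁆ a ≡ true
⁅⁆-refl a = dec-true (a ≟ a) refl

⁅⁆⁻ : ∀ {a v : Fin n} → ⁅ a ⁆ v ≡ true → v ≡ a
⁅⁆⁻ {a = a} {v} v∈⁅a⁆ with v ≟ a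
... | yes v≡a = v≡a

∖⁅⁆⁺ : ∀ {p : Fin n → Bool} {w v} → p v ≡ true → v ≢ w → (p ∖ ⁅ w ⁆) v ≡ true
∖⁅⁆⁺ {w = w} {v} pv v≢w = ∧-true⁺ pv (not-true⁺ (dec-false (v ≟ w) v≢w))

∖⁅⁆⁻ : ∀ {p : Fin n → Bool} {w v} → (p ∖ ⁅ w ⁆) v ≡ true → p v ≡ true × v ≢ w
∖⁅⁆⁻ {w = w} {v} v∈p∖w with ∧-true⁻ v∈p∖w
... | pv , v∉⁅w⁆ = pv , λ { refl → true≢false (⁅⁆-refl w) (not-true⁻ v∉⁅w⁆) }

sum-mono-≤ : {f g : Fin n → ℕ} → (∀ i → f i ≤ g i) → sum f ≤ sum g
sum-mono-≤ {zero}  _     = z≤n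
sum-mono-≤ {suc n} f≤g = +-mono-≤ (f≤g zero) (sum-mono-≤ (f≤g ∘ suc))

sumF≡sum : (f : Fin n → ℕ) → sumF f ≡ sum f
sumF≡sum {zero}  f = refl
sumF≡sum {suc n} f = cong (f zero +_) (sumF≡sum (f ∘ suc))

countF≡sum : (p : Fin n → Bool) → countF p ≡ sum (𝟙 ∘ p)
countF≡sum {zero}  p = refl
countF≡sum {suc n} p = cong (𝟙 (p zero) +_) (countF≡sum (p ∘ suc))

countF-+ : (p q : Fin n → Bool) → countF p + countF q ≡ ∑[ i < n ] (𝟙 (p i) + 𝟙 (q i))
countF-+ p q = trans (cong₂ _+_ (countF≡sum p) (countF≡sum q)) (≡.sym (∑-distrib-+ (𝟙 ∘ p) (𝟙 ∘ q)))

countF-mono : {p q : Fin n → Bool} → (∀ i → p i ≡ true → q i ≡ true) → countF p ≤ countF q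
countF-mono {p = p} {q} p⊆q = begin
  countF p      ≡⟨ countF≡sum p ⟩
  sum (𝟙 ∘ p)   ≤⟨ sum-mono-≤ (λ i → 𝟙-mono (p⊆q i)) ⟩
  sum (𝟙 ∘ q)   ≡⟨ countF≡sum q ⟨
  countF q      ∎
  where open ≤-Reasoning

module _ {p q s : Fin n → Bool} where

  countF-+-≤ : (∀ i → p i ≡ true → q i ≡ true → ⊥)
    → (∀ i → p i ≡ true → s i ≡ true) → (∀ i → q i ≡ true → s i ≡ true)
    → countF p + countF q ≤ countF s
  countF-+-≤ disjoint p⊆s q⊆s = begin
    countF p + countF q             ≡⟨ countF-+ p q ⟩
    ∑[ i < n ] (𝟙 (p i) + 𝟙 (q i))  ≤⟨ sum-mono-≤ (λ i → 𝟙-+-≤ (disjoint i) (p⊆s i) (q⊆s i)) ⟩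
    sum (𝟙 ∘ s)                     ≡⟨ countF≡sum s ⟨
    countF s                        ∎
    where open ≤-Reasoning

  countF-≤-+ : (∀ i → s i ≡ true → p i ≡ true ⊎ q i ≡ true) → countF s ≤ countF p + countF q
  countF-≤-+ s⊆p∪q = begin
    countF s                        ≡⟨ countF≡sum s ⟩
    sum (𝟙 ∘ s)                     ≤⟨ sum-mono-≤ (λ i → 𝟙-≤-+ (s⊆p∪q i)) ⟩
    ∑[ i < n ] (𝟙 (p i) + 𝟙 (q i))  ≡⟨ countF-+ p q ⟨
    countF p + countF q             ∎
    where open ≤-Reasoning

  countF-partition : (∀ i → p i ≡ true → q i ≡ true → ⊥)
    → (∀ i → p i ≡ true → s i ≡ true) → (∀ i → q i ≡ true → s i ≡ true)
    → (∀ i → s i ≡ true → p i ≡ true ⊎ q i ≡ true)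
    → countF p + countF q ≡ countF s
  countF-partition disjoint p⊆s q⊆s s⊆p∪q =
    ≤-antisym (countF-+-≤ disjoint p⊆s q⊆s) (countF-≤-+ s⊆p∪q)

countF-true : ∀ n → countF {n} (λ _ → true) ≡ n
countF-true zero    = refl
countF-true (suc n) = cong suc (countF-true n)

countF-false : ∀ n → countF {n} (λ _ → false) ≡ 0
countF-false zero    = refl
countF-false (suc n) = countF-false n

countF-⁅⁆ : (a : Fin n) → countF ⁅ a ⁆ ≡ 1
countF-⁅⁆ {suc n} zero    = cong suc (countF-false n)
countF-⁅⁆ {suc n} (suc a) = countF-⁅⁆ a

countF-complement : (p : Fin n → Bool) → countF p + countF (not ∘ p) ≡ n
countF-complement {n} p = trans (countF-partition disjoint (λ _ _ → refl) (λ _ _ → refl) cover) (countF-true n)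
  where
  disjoint : ∀ i → p i ≡ true → not (p i) ≡ true → ⊥
  disjoint i pi ¬pi = true≢false pi (not-true⁻ ¬pi)
  cover : ∀ i → true ≡ true → p i ≡ true ⊎ not (p i) ≡ true
  cover i _ with p i
  ... | true  = inj₁ refl
  ... | false = inj₂ refl

countF-insert : {C : Fin n → Bool} (b : Fin n) → C b ≡ false → countF (C ∪ ⁅ b ⁆) ≡ suc (countF C)
countF-insert {C = C} b Cb = begin
  countF (C ∪ ⁅ b ⁆)        ≡⟨ countF-partition disjoint (λ _ → ∨-true⁺ˡ) (λ _ → ∨-true⁺ʳ) (λ _ → ∨-true⁻) ⟨
  countF C + countF ⁅ b ⁆   ≡⟨ cong (countF C +_) (countF-⁅⁆ b) ⟩
  countF C + 1              ≡⟨ +-comm (countF C) 1 ⟩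
  suc (countF C)            ∎
  where
  open ≡-Reasoning
  disjoint : ∀ i → C i ≡ true → ⁅ b ⁆ i ≡ true → ⊥
  disjoint i Ci i≡b = true≢false (subst (λ v → C v ≡ true) (⁅⁆⁻ i≡b) Ci) Cb

countF-remove : (p : Fin n → Bool) {w : Fin n} → p w ≡ true → countF p ≡ suc (countF (p ∖ ⁅ w ⁆))
countF-remove p {w} pw = begin
  countF p                          ≡⟨ countF-partition disjoint (λ _ → proj₁ ∘ ∧-true⁻) ⁅w⁆⊆p cover ⟨
  countF (p ∖ ⁅ w ⁆) + countF ⁅ w ⁆ ≡⟨ cong (countF (p ∖ ⁅ w ⁆) +_) (countF-⁅⁆ w) ⟩
  countF (p ∖ ⁅ w ⁆) + 1            ≡⟨ +-comm _ 1 ⟩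
  suc (countF (p ∖ ⁅ w ⁆))          ∎
  where
  open ≡-Reasoning
  disjoint : ∀ i → (p ∖ ⁅ w ⁆) i ≡ true → ⁅ w ⁆ i ≡ true → ⊥
  disjoint i i∈p∖w i≡w = proj₂ (∖⁅⁆⁻ {p = p} i∈p∖w) (⁅⁆⁻ i≡w)
  ⁅w⁆⊆p : ∀ i → ⁅ w ⁆ i ≡ true → p i ≡ true
  ⁅w⁆⊆p i i≡w = subst (λ v → p v ≡ true) (≡.sym (⁅⁆⁻ i≡w)) pw
  cover : ∀ i → p i ≡ true → (p ∖ ⁅ w ⁆) i ≡ true ⊎ ⁅ w ⁆ i ≡ true
  cover i pi with i ≟ w
  ... | yes _   = inj₂ refl
  ... | no  _   = inj₁ (∧-true⁺ pi refl)

countF-pos : (p : Fin n → Bool) {w : Fin n} → p w ≡ true → 1 ≤ countF p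
countF-pos p pw = subst (1 ≤_) (≡.sym (countF-remove p pw)) (s≤s z≤n)

memberOf : List (Fin n) → Fin n → Bool
memberOf L v = does (any? (v ≟_) L)

∈⇒memberOf : ∀ {L : List (Fin n)} {v} → v ∈ L → memberOf L v ≡ true
∈⇒memberOf {L = L} {v} v∈L = dec-true (any? (v ≟_) L) v∈L

countF-memberOf : (L : List (Fin n)) → countF (memberOf L) ≤ length L
countF-memberOf {n} []      = ≤-reflexive (countF-false n)
countF-memberOf     (a ∷ L) = begin
  countF (memberOf (a ∷ L))           ≤⟨ countF-≤-+ {p = ⁅ a ⁆} {memberOf L} (λ _ → ∨-true⁻) ⟩
  countF ⁅ a ⁆ + countF (memberOf L)  ≡⟨ cong (_+ countF (memberOf L)) (countF-⁅⁆ a) ⟩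
  suc (countF (memberOf L))           ≤⟨ s≤s (countF-memberOf L) ⟩
  suc (length L)                      ∎
  where open ≤-Reasoning

countF≤1⇒unique : (p : Fin n → Bool) → countF p ≤ 1 → ∀ {u w} → p u ≡ true → p w ≡ true → w ≡ u
countF≤1⇒unique p ≤1 {u} {w} pu pw with w ≟ u
... | yes w≡u = w≡u
... | no  w≢u = ⊥-elim (≤⇒≯ ≤1 (begin-strict
  1                         <⟨ s≤s (countF-pos (p ∖ ⁅ u ⁆) (∖⁅⁆⁺ {p = p} pw w≢u)) ⟩
  suc (countF (p ∖ ⁅ u ⁆))  ≡⟨ countF-remove p pu ⟨
  countF p                  ∎))
  where open ≤-Reasoning

countF≤1⇒⊆⁅⁆ : (p : Fin n → Bool) → Fin n → countF p ≤ 1 → ∃ λ u → ∀ w → p w ≡ true → w ≡ u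
countF≤1⇒⊆⁅⁆ p d ≤1 with anyFin? (λ w → p w ≟ᴮ true)
... | yes (u , pu) = u , λ w pw → countF≤1⇒unique p ≤1 pu pw
... | no  ∄u       = d , λ w pw → ⊥-elim (∄u (w , pw))

*-countF≤sum : (k : ℕ) (p : Fin n → Bool) (f : Fin n → ℕ) → (∀ i → p i ≡ true → k ≤ f i)
  → k * countF p ≤ sum f
*-countF≤sum k p f k≤f = begin
  k * countF p              ≡⟨ cong (k *_) (countF≡sum p) ⟩
  k * sum (𝟙 ∘ p)           ≡⟨ *-distribˡ-sum k (𝟙 ∘ p) ⟩
  ∑[ i < _ ] (k * 𝟙 (p i))  ≤⟨ sum-mono-≤ term ⟩
  sum f                     ∎
  where
  open ≤-Reasoning
  term : ∀ i → k * 𝟙 (p i) ≤ f i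
  term i with p i in pi
  ... | false = ≤-trans (≤-reflexive (*-zeroʳ k)) z≤n
  ... | true  = ≤-trans (≤-reflexive (*-identityʳ k)) (k≤f i pi)

length≤countF : (R : Fin n → Fin n → Set) {p : Fin n → Bool} {vs : List (Fin n)}
  → AllPairs (λ u v → ∀ {a b} → R u a → R v b → a ≢ b) vs
  → All (λ v → ∃ λ w → R v w × p w ≡ true) vs
  → length vs ≤ countF p
length≤countF R [] [] = z≤n
length≤countF R {p} {v ∷ vs} (separated ∷ seps) ((w , Rvw , pw) ∷ wits) = begin
  suc (length vs)           ≤⟨ s≤s (length≤countF R seps (All.zipWith avoid (separated , wits))) ⟩
  suc (countF (p ∖ ⁅ w ⁆))  ≡⟨ countF-remove p pw ⟨
  countF p                  ∎
  where
  open ≤-Reasoning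
  avoid : ∀ {u} → (∀ {a b} → R v a → R u b → a ≢ b) × (∃ λ w′ → R u w′ × p w′ ≡ true)
    → ∃ λ w′ → R u w′ × (p ∖ ⁅ w ⁆) w′ ≡ true
  avoid (sep , w′ , Ruw′ , pw′) = w′ , Ruw′ , ∖⁅⁆⁺ {p = p} pw′ (λ w′≡w → sep Rvw Ruw′ (≡.sym w′≡w))

upper : (Fin n → Fin n → Bool) → Fin n → Fin n → Bool
upper r i j = (toℕ i <ᵇ toℕ j) ∧ r i j

upper-mono : (r s : Fin n → Fin n → Bool) {i j : Fin n} → (r i j ≡ true → s i j ≡ true)
  → upper r i j ≡ true → upper s i j ≡ true
upper-mono _ _ r⇒s rij with ∧-true⁻ rij
... | i<j , r = ∧-true⁺ i<j (r⇒s r)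

<ᵇ-total : {i j : Fin n} → i ≢ j → (toℕ i <ᵇ toℕ j) ≡ true ⊎ (toℕ j <ᵇ toℕ i) ≡ true
<ᵇ-total {i = i} {j} i≢j with <-cmp (toℕ i) (toℕ j)
... | tri< i<j _ _ = inj₁ (Equivalence.to T-≡ (<⇒<ᵇ i<j))
... | tri≈ _ i≡j _ = ⊥-elim (i≢j (toℕ-injective i≡j))
... | tri> _ _ j<i = inj₂ (Equivalence.to T-≡ (<⇒<ᵇ j<i))

term≤sumF : (f : Fin n → ℕ) (i : Fin n) → f i ≤ sumF f
term≤sumF f zero    = m≤m+n _ _
term≤sumF f (suc i) = ≤-trans (term≤sumF (f ∘ suc) i) (m≤n+m _ _)

edgeCount≡∑∑ : (r : Fin n → Fin n → Bool) → edgeCount r ≡ ∑[ i < n ] ∑[ j < n ] 𝟙 (upper r i j)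
edgeCount≡∑∑ r = trans (sumF≡sum (countF ∘ upper r)) (sum-cong-≗ (λ i → countF≡sum (upper r i)))

edgeCount-pos : (r : Fin n → Fin n → Bool) {i j : Fin n} → i ≢ j → r i j ≡ true → r j i ≡ true
  → 1 ≤ edgeCount r
edgeCount-pos r {i} {j} i≢j rij rji with <ᵇ-total i≢j
... | inj₁ i<j = ≤-trans (countF-pos (upper r i) (∧-true⁺ i<j rij)) (term≤sumF (countF ∘ upper r) i)
... | inj₂ j<i = ≤-trans (countF-pos (upper r j) (∧-true⁺ j<i rji)) (term≤sumF (countF ∘ upper r) j)

edgeCount-+-≤ : {p q s : Fin n → Fin n → Bool} → (∀ i j → p i j ≡ true → q i j ≡ true → ⊥)
  → (∀ i j → p i j ≡ true → s i j ≡ true) → (∀ i j → q i j ≡ true → s i j ≡ true)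
  → edgeCount p + edgeCount q ≤ edgeCount s
edgeCount-+-≤ {n} {p} {q} {s} disjoint p⊆s q⊆s = begin
  edgeCount p + edgeCount q
    ≡⟨ cong₂ _+_ (sumF≡sum (countF ∘ upper p)) (sumF≡sum (countF ∘ upper q)) ⟩
  sum (countF ∘ upper p) + sum (countF ∘ upper q)
    ≡⟨ ∑-distrib-+ (countF ∘ upper p) (countF ∘ upper q) ⟨
  ∑[ i < n ] (countF (upper p i) + countF (upper q i))
    ≤⟨ sum-mono-≤ row ⟩
  sum (countF ∘ upper s)
    ≡⟨ sumF≡sum (countF ∘ upper s) ⟨
  edgeCount s ∎
  where
  open ≤-Reasoning
  row : ∀ i → countF (upper p i) + countF (upper q i) ≤ countF (upper s i)
  row i = countF-+-≤ (λ j pij qij → disjoint i j (proj₂ (∧-true⁻ pij)) (proj₂ (∧-true⁻ qij)))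
                     (λ j → upper-mono p s (p⊆s i j)) (λ j → upper-mono q s (q⊆s i j))

edgeCount-mono : (p s : Fin n → Fin n → Bool) → (∀ i j → p i j ≡ true → s i j ≡ true)
  → edgeCount p ≤ edgeCount s
edgeCount-mono p s p⊆s = begin
  edgeCount p             ≡⟨ sumF≡sum (countF ∘ upper p) ⟩
  sum (countF ∘ upper p)  ≤⟨ sum-mono-≤ (λ i → countF-mono (λ j → upper-mono p s (p⊆s i j))) ⟩
  sum (countF ∘ upper s)  ≡⟨ sumF≡sum (countF ∘ upper s) ⟨
  edgeCount s             ∎
  where open ≤-Reasoning

degree-sum≤edgeCount : (G : Graph n) (D : Fin n → Fin n → Bool)
  → (∀ i j → D i j ≡ true → adj G i j ≡ true) → (∀ i j → D i j ≡ true → D j i ≡ true → ⊥)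
  → ∑[ i < n ] degree D i ≤ edgeCount (adj G)
degree-sum≤edgeCount {n} G D D⊆G asym = begin
  ∑[ i < n ] degree D i
    ≡⟨ sum-cong-≗ (λ i → countF≡sum (D i)) ⟩
  ∑[ i < n ] ∑[ j < n ] 𝟙 (D i j)
    ≤⟨ sum-mono-≤ (λ i → sum-mono-≤ (λ j → 𝟙-≤-+ (oriented i j))) ⟩
  ∑[ i < n ] ∑[ j < n ] (𝟙 (upper D i j) + 𝟙 (upper (flip D) j i))
    ≡⟨ sum-cong-≗ (λ i → ∑-distrib-+ (λ j → 𝟙 (upper D i j)) (λ j → 𝟙 (upper (flip D) j i))) ⟩
  ∑[ i < n ] (∑[ j < n ] 𝟙 (upper D i j) + ∑[ j < n ] 𝟙 (upper (flip D) j i))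
    ≡⟨ ∑-distrib-+ (λ i → ∑[ j < n ] 𝟙 (upper D i j)) (λ i → ∑[ j < n ] 𝟙 (upper (flip D) j i)) ⟩
  ∑[ i < n ] ∑[ j < n ] 𝟙 (upper D i j) + ∑[ i < n ] ∑[ j < n ] 𝟙 (upper (flip D) j i)
    ≡⟨ cong (∑[ i < n ] ∑[ j < n ] 𝟙 (upper D i j) +_) (∑-comm (λ i j → 𝟙 (upper (flip D) j i))) ⟩
  ∑[ i < n ] ∑[ j < n ] 𝟙 (upper D i j) + ∑[ j < n ] ∑[ i < n ] 𝟙 (upper (flip D) j i)
    ≡⟨ cong₂ _+_ (edgeCount≡∑∑ D) (edgeCount≡∑∑ (flip D)) ⟨
  edgeCount D + edgeCount (flip D)
    ≤⟨ edgeCount-+-≤ asym D⊆G (λ i j Dji → trans (sym G i j) (D⊆G j i Dji)) ⟩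
  edgeCount (adj G) ∎
  where
  open ≤-Reasoning
  oriented : ∀ i j → D i j ≡ true → upper D i j ≡ true ⊎ upper (flip D) j i ≡ true
  oriented i j Dij with <ᵇ-total {i = i} {j} (λ { refl → true≢false (D⊆G i i Dij) (irrefl G i) })
  ... | inj₁ i<j = inj₁ (∧-true⁺ i<j Dij)
  ... | inj₂ j<i = inj₂ (∧-true⁺ j<i Dij)

-- Induced subgraphs, edge deletion and walks

-- G [ S ] keeps the vertex set Fin n; the vertices outside S become isolated.
_[_] : Graph n → (Fin n → Bool) → Graph n
adj    (G [ S ]) i j = (S i ∧ S j) ∧ adj G i j
sym    (G [ S ]) i j = cong₂ _∧_ (∧-comm (S i) (S j)) (sym G i j)
irrefl (G [ S ]) i   = trans (cong ((S i ∧ S i) ∧_) (irrefl G i)) (∧-zeroʳ (S i ∧ S i))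

_-_ : {side : Fin n → Bool} (G : Graph n) → BipSub G side → Graph n
adj    (G - F) i j = adj G i j ∧ not (fadj F i j)
sym    (G - F) i j = cong₂ (λ a b → a ∧ not b) (sym G i j) (fsym F i j)
irrefl (G - F) i   = cong (_∧ not (fadj F i i)) (irrefl G i)

module _ {G : Graph n} {S : Fin n → Bool} {i j : Fin n} where

  induced⁺ : S i ≡ true → S j ≡ true → adj G i j ≡ true → adj (G [ S ]) i j ≡ true
  induced⁺ Si Sj Gij = ∧-true⁺ (∧-true⁺ Si Sj) Gij

  induced⁻ : adj (G [ S ]) i j ≡ true → S i ≡ true × S j ≡ true × adj G i j ≡ true
  induced⁻ Sij with ∧-true⁻ Sij
  ... | SiSj , Gij = proj₁ (∧-true⁻ SiSj) , proj₂ (∧-true⁻ SiSj) , Gij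


induced-mono : {G : Graph n} {S T : Fin n → Bool} {i j : Fin n} → (∀ v → S v ≡ true → T v ≡ true)
  → adj (G [ S ]) i j ≡ true → adj (G [ T ]) i j ≡ true
induced-mono {G = G} {S} {T} {i} {j} S⊆T Sij with induced⁻ {G = G} {S} Sij
... | Si , Sj , Gij = induced⁺ {G = G} {T} (S⊆T i Si) (S⊆T j Sj) Gij

edgeCount-insert : (G : Graph n) {C : Fin n → Bool} {a b : Fin n}
  → C a ≡ true → C b ≡ false → adj G a b ≡ true
  → suc (edgeCount (adj (G [ C ]))) ≤ edgeCount (adj (G [ C ∪ ⁅ b ⁆ ]))
edgeCount-insert {n} G {C} {a} {b} Ca Cb Gab = begin
  suc (edgeCount (adj (G [ C ])))             ≡⟨ +-comm 1 _ ⟩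
  edgeCount (adj (G [ C ])) + 1               ≤⟨ +-monoʳ-≤ _ (edgeCount-pos new a≢b new-ab new-ba) ⟩
  edgeCount (adj (G [ C ])) + edgeCount new   ≤⟨ edgeCount-+-≤ disjoint old⊆ (λ i j → proj₁ ∘ ∧-true⁻) ⟩
  edgeCount (adj (G [ C ∪ ⁅ b ⁆ ]))           ∎
  where
  open ≤-Reasoning
  new : Fin n → Fin n → Bool
  new i j = adj (G [ C ∪ ⁅ b ⁆ ]) i j ∧ not (adj (G [ C ]) i j)
  a≢b : a ≢ b
  a≢b refl = true≢false Ca Cb
  new-ab : new a b ≡ true
  new-ab rewrite Ca | Cb | ⁅⁆-refl b | Gab = refl
  new-ba : new b a ≡ true
  new-ba = trans (cong₂ (λ x y → x ∧ not y) (sym (G [ C ∪ ⁅ b ⁆ ]) b a) (sym (G [ C ]) b a)) new-ab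
  disjoint : ∀ i j → adj (G [ C ]) i j ≡ true → new i j ≡ true → ⊥
  disjoint i j Cij newij = true≢false Cij (not-true⁻ (proj₂ (∧-true⁻ newij)))
  old⊆ : ∀ i j → adj (G [ C ]) i j ≡ true → adj (G [ C ∪ ⁅ b ⁆ ]) i j ≡ true
  old⊆ i j = induced-mono {G = G} {C} (λ _ → ∨-true⁺ˡ)

module _ {G : Graph n} {S : Fin n → Bool} where

  walk-source : ∀ {u v} → WalkIn G S u v → S u ≡ true
  walk-source (here Su)     = Su
  walk-source (step Su _ _) = Su

  walk-target : ∀ {u v} → WalkIn G S u v → S v ≡ true
  walk-target (here Sv)    = Sv
  walk-target (step _ _ W) = walk-target W

  infixr 5 _++ʷ_

  _++ʷ_ : ∀ {u v w} → WalkIn G S u v → WalkIn G S v w → WalkIn G S u w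
  here _      ++ʷ W′ = W′
  step Su e W ++ʷ W′ = step Su e (W ++ʷ W′)

  walk-reverse : ∀ {u v} → WalkIn G S u v → WalkIn G S v u
  walk-reverse (here Su)                 = here Su
  walk-reverse (step {u} {v} Su Guv W) =
    walk-reverse W ++ʷ step (walk-source W) (trans (sym G v u) Guv) (here Su)

  walk-crossing : (C : Fin n → Bool) → ∀ {u v} → WalkIn G S u v → C u ≡ true → C v ≡ false
    → ∃₂ λ a b → C a ≡ true × C b ≡ false × S b ≡ true × adj G a b ≡ true
  walk-crossing C (here _) Cu Cv = ⊥-elim (true≢false Cu Cv)
  walk-crossing C (step {v = v} _ Guv W) Cu Cw with C v in Cv
  ... | true  = walk-crossing C W Cv Cw
  ... | false = _ , v , Cu , Cv , walk-source W , Guv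

walk-map : {G H : Graph n} {S T : Fin n → Bool} → (∀ u → S u ≡ true → T u ≡ true)
  → (∀ u v → S u ≡ true → S v ≡ true → adj G u v ≡ true → adj H u v ≡ true)
  → ∀ {u v} → WalkIn G S u v → WalkIn H T u v
walk-map S⊆T G⇒H (here Su)       = here (S⊆T _ Su)
walk-map S⊆T G⇒H (step Su Guv W) = step (S⊆T _ Su) (G⇒H _ _ Su (walk-source W) Guv) (walk-map S⊆T G⇒H W)

-- Components

Reaches : Graph n → (Fin n → Bool) → List (Fin n) → Fin n → Set
Reaches G S L v = ∃ λ ρ → ρ ∈ L × WalkIn G S ρ v

-- Stated under double negation, so that reachability can be decided classically.
Covers : Graph n → (Fin n → Bool) → List (Fin n) → Set
Covers G S L = ∀ v → S v ≡ true → ¬ ¬ Reaches G S L v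

module _ (G : Graph n) (S : Fin n → Bool) (L : List (Fin n)) (covered : Covers G S L) where

  private
    SpanningBound : (Fin n → Bool) → Set
    SpanningBound C = countF C ≤ edgeCount (adj (G [ C ])) + length L

    Missing : (Fin n → Bool) → Fin n → Set
    Missing C v = S v ≡ true × C v ≡ false

    missing? : (C : Fin n → Bool) → Dec (∃ (Missing C))
    missing? C = anyFin? (λ v → (S v ≟ᴮ true) ×-dec (C v ≟ᴮ false))

    module _ {C : Fin n → Bool} (C⊆S : ∀ v → C v ≡ true → S v ≡ true) where

      saturated : ¬ ∃ (Missing C) → SpanningBound C → SpanningBound S
      saturated ∄v bound = begin
        countF S                                   ≤⟨ countF-mono S⊆C ⟩
        countF C                                   ≤⟨ bound ⟩
        edgeCount (adj (G [ C ])) + length L       ≤⟨ +-monoˡ-≤ (length L) C-edges≤S-edges ⟩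
        edgeCount (adj (G [ S ])) + length L       ∎
        where
        open ≤-Reasoning
        C-edges≤S-edges : edgeCount (adj (G [ C ])) ≤ edgeCount (adj (G [ S ]))
        C-edges≤S-edges = edgeCount-mono (adj (G [ C ])) (adj (G [ S ])) (λ i j → induced-mono {G = G} C⊆S)
        S⊆C : ∀ v → S v ≡ true → C v ≡ true
        S⊆C v Sv with C v in Cv
        ... | true  = refl
        ... | false = ⊥-elim (∄v (v , Sv , Cv))

      insert-⊆ : ∀ {v} → S v ≡ true → ∀ u → (C ∪ ⁅ v ⁆) u ≡ true → S u ≡ true
      insert-⊆ Sv u Cu∨u≡v with ∨-true⁻ Cu∨u≡v
      ... | inj₁ Cu  = C⊆S u Cu
      ... | inj₂ u≡v = subst (λ w → S w ≡ true) (≡.sym (⁅⁆⁻ u≡v)) Sv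

      missing⇒< : ∀ {v} → Missing C v → suc (countF C) ≤ countF S
      missing⇒< {v} (Sv , Cv) = subst (_≤ countF S) (countF-insert v Cv) (countF-mono (insert-⊆ Sv))

    insert-bound : ∀ {C a b} → C a ≡ true → C b ≡ false → adj G a b ≡ true
      → SpanningBound C → SpanningBound (C ∪ ⁅ b ⁆)
    insert-bound {C} {a} {b} Ca Cb Gab bound = begin
      countF (C ∪ ⁅ b ⁆)                          ≡⟨ countF-insert b Cb ⟩
      suc (countF C)                              ≤⟨ s≤s bound ⟩
      suc (edgeCount (adj (G [ C ]))) + length L  ≤⟨ +-monoˡ-≤ (length L) (edgeCount-insert G Ca Cb Gab) ⟩
      edgeCount (adj (G [ C ∪ ⁅ b ⁆ ])) + length L ∎
      where open ≤-Reasoning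

    -- Grow a forest C from the roots: a walk from a root to a vertex of S outside C leaves C
    -- along an edge ab, and adding b to C adds one vertex and at least one edge.
    grow : ∀ k C → (∀ v → C v ≡ true → S v ≡ true) → (∀ ρ → ρ ∈ L → S ρ ≡ true → C ρ ≡ true)
      → SpanningBound C → countF S ≤ k + countF C → ¬ ¬ SpanningBound S
    grow zero C C⊆S roots⊆C bound fuel with missing? C
    ... | no  ∄v           = pure (saturated C⊆S ∄v bound)
    ... | yes (_ , missing) = ⊥-elim (1+n≰n (≤-trans (missing⇒< C⊆S missing) fuel))
    grow (suc k) C C⊆S roots⊆C bound fuel with missing? C
    ... | no  ∄v                = pure (saturated C⊆S ∄v bound)
    ... | yes (v , Sv , Cv) = do
      ρ , ρ∈L , W ← covered v Sv
      let a , b , Ca , Cb , Sb , Gab = walk-crossing C W (roots⊆C ρ ρ∈L (walk-source W)) Cv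
      grow k (C ∪ ⁅ b ⁆) (insert-⊆ C⊆S Sb) (λ ρ ρ∈L Sρ → ∨-true⁺ˡ (roots⊆C ρ ρ∈L Sρ))
        (insert-bound Ca Cb Gab bound)
        (≤-trans fuel (≤-reflexive (begin
          suc k + countF C     ≡⟨ +-suc k (countF C) ⟨
          k + suc (countF C)   ≡⟨ cong (k +_) (countF-insert b Cb) ⟨
          k + countF (C ∪ ⁅ b ⁆) ∎)))
      where open ≡-Reasoning

  spanning-forest : ¬ ¬ (countF S ≤ edgeCount (adj (G [ S ])) + length L)
  spanning-forest = grow (countF S) (λ v → S v ∧ memberOf L v)
    (λ _ → proj₁ ∘ ∧-true⁻)
    (λ ρ ρ∈L Sρ → ∧-true⁺ Sρ (∈⇒memberOf ρ∈L))
    (≤-trans (countF-mono {p = λ v → S v ∧ memberOf L v} (λ _ → proj₂ ∘ ∧-true⁻))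
             (≤-trans (countF-memberOf L) (m≤n+m _ _)))
    (m≤m+n _ _)

Scattered : Graph n → (Fin n → Bool) → List (Fin n) → Set
Scattered G S L = All (λ v → S v ≡ true) L × AllPairs (λ u v → ¬ WalkIn G S u v) L

cover-or-scatter : (G : Graph n) (S : Fin n → Bool) {x : Fin n} → S x ≡ true → ∀ k
  → ¬ ¬ ((∃ λ vs → length vs < k × Covers G S (x ∷ vs))
         ⊎ (∃ λ vs → length vs ≡ k × Scattered G S (x ∷ vs)))
cover-or-scatter G S Sx zero    = pure (inj₂ ([] , refl , Sx ∷ [] , [] ∷ []))
cover-or-scatter G S {x} Sx (suc k) = do
  inj₂ (vs , |vs|≡k , _ ∷ Svs , x≁vs ∷ pairs) ← cover-or-scatter G S Sx k
    where inj₁ (vs , |vs|<k , covered) → pure (inj₁ (vs , m≤n⇒m≤1+n |vs|<k , covered))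
  yes (v , Sv , unreached) ← ¬¬-excluded-middle {A = ∃ λ v → S v ≡ true × ¬ Reaches G S (x ∷ vs) v}
    where no ∄v → pure (inj₁ (vs , s≤s (≤-reflexive |vs|≡k) , λ v Sv ¬reached → ∄v (v , Sv , ¬reached)))
  let x≁v : ¬ WalkIn G S x v
      x≁v W = unreached (x , here refl , W)
      v≁vs : All (λ u → ¬ WalkIn G S v u) vs
      v≁vs = All.tabulate (λ u∈vs W → unreached (_ , there u∈vs , walk-reverse W))
  pure (inj₂ (v ∷ vs , cong suc |vs|≡k , Sx ∷ Sv ∷ Svs , (x≁v ∷ x≁vs) ∷ v≁vs ∷ pairs))

scattered⇒edges≥ : (G : Graph n) (side : Fin n → Bool) (x y : Fin n)
  → (∀ y′ → side y′ ≡ false → y′ ≢ y → ∀ v → side v ≡ true → ¬ WalkIn G side x v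
       → ∃ λ w → WalkIn G side v w × adj G y′ w ≡ true)
  → ∀ {vs} → Scattered G side (x ∷ vs)
  → length vs * countF ((not ∘ side) ∖ ⁅ y ⁆) ≤ edgeCount (adj G)
scattered⇒edges≥ {n} G side x y sees {vs} (_ ∷ Svs , x≁vs ∷ pairs) = begin
  length vs * countF ((not ∘ side) ∖ ⁅ y ⁆)  ≤⟨ *-countF≤sum (length vs) _ (degree D) many-neighbours ⟩
  ∑[ i < n ] degree D i                      ≤⟨ degree-sum≤edgeCount G D D⊆G D-asym ⟩
  edgeCount (adj G)                          ∎
  where
  open ≤-Reasoning
  D : Fin n → Fin n → Bool
  D i j = not (side i) ∧ side j ∧ adj G i j
  D⁻ : ∀ {i j} → D i j ≡ true → side i ≡ false × side j ≡ true × adj G i j ≡ true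
  D⁻ {i} {j} Dij with ∧-true⁻ {not (side i)} Dij
  ... | Yi , XjGij = not-true⁻ Yi , ∧-true⁻ {side j} XjGij
  D⊆G : ∀ i j → D i j ≡ true → adj G i j ≡ true
  D⊆G i j = proj₂ ∘ proj₂ ∘ D⁻
  D-asym : ∀ i j → D i j ≡ true → D j i ≡ true → ⊥
  D-asym i j Dij Dji = true≢false (proj₁ (proj₂ (D⁻ Dji))) (proj₁ (D⁻ Dij))
  separated : ∀ {u v} → ¬ WalkIn G side u v → ∀ {a b} → WalkIn G side u a → WalkIn G side v b → a ≢ b
  separated u≁v Wua Wvb refl = u≁v (Wua ++ʷ walk-reverse Wvb)
  many-neighbours : ∀ i → ((not ∘ side) ∖ ⁅ y ⁆) i ≡ true → length vs ≤ degree D i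
  many-neighbours i i∈Y∖y with ∖⁅⁆⁻ {p = not ∘ side} i∈Y∖y
  ... | i∈Y , i≢y =
    length≤countF (WalkIn G side) (AllPairs.map separated pairs) (All.zipWith neighbour (Svs , x≁vs))
    where
    neighbour : ∀ {v} → side v ≡ true × ¬ WalkIn G side x v → ∃ λ w → WalkIn G side v w × D i w ≡ true
    neighbour (Sv , x≁v) with sees i (not-true⁻ i∈Y) i≢y _ Sv x≁v
    ... | w , W , iw = w , W , ∧-true⁺ i∈Y (∧-true⁺ (walk-target W) iw)

fadj-same-side : {G : Graph n} {side : Fin n → Bool} (F : BipSub G side) {i j : Fin n}
  → side i ≡ side j → fadj F i j ≡ false
fadj-same-side F {i} {j} same with fadj F i j in Fij
... | false = refl
... | true  = ⊥-elim (not-¬ same (fcross F i j Fij))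

Y∪x′-covered : (G : Graph n) (side : Fin n → Bool) (x y : Fin n)
  → (∀ x′ → side x′ ≡ true → x′ ≢ x → ∀ v → side v ≡ false → ¬ WalkIn G (not ∘ side) y v
       → ∃ λ w → WalkIn G (not ∘ side) v w × adj G x′ w ≡ true)
  → ∀ {x′} → side x′ ≡ true → x′ ≢ x
  → (F : BipSub G side) {y₀ : Fin n} → (∀ w → fadj F x′ w ≡ true → w ≡ y₀)
  → Covers (G - F) ((not ∘ side) ∪ ⁅ x′ ⁆) (y ∷ x′ ∷ y₀ ∷ [])
Y∪x′-covered {n} G side x y sees {x′} sx′ x′≢x F {y₀} y₀-unique v v∈S′ = reach (∨-true⁻ v∈S′)
  where
  S′ : Fin n → Bool
  S′ = (not ∘ side) ∪ ⁅ x′ ⁆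
  x′∈S′ : S′ x′ ≡ true
  x′∈S′ = ∨-true⁺ʳ (⁅⁆-refl x′)
  lift : ∀ {u w} → WalkIn G (not ∘ side) u w → WalkIn (G - F) S′ u w
  lift = walk-map (λ _ → ∨-true⁺ˡ) λ a b Ya Yb Gab →
    ∧-true⁺ Gab (not-true⁺ (fadj-same-side F (trans (not-true⁻ Ya) (≡.sym (not-true⁻ Yb)))))
  via : ∀ {w} → WalkIn G (not ∘ side) v w → adj G x′ w ≡ true → Reaches (G - F) S′ (y ∷ x′ ∷ y₀ ∷ []) v
  via {w} Wvw x′w with fadj F x′ w in Fx′w
  ... | true  = y₀ , there (there (here refl)) ,
                subst (λ u → WalkIn (G - F) S′ u v) (y₀-unique w Fx′w) (walk-reverse (lift Wvw))
  ... | false = x′ , there (here refl) , step x′∈S′ (∧-true⁺ x′w (not-true⁺ Fx′w)) (walk-reverse (lift Wvw))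
  reach : not (side v) ≡ true ⊎ ⁅ x′ ⁆ v ≡ true → ¬ ¬ Reaches (G - F) S′ (y ∷ x′ ∷ y₀ ∷ []) v
  reach (inj₂ v≡x′) =
    pure (x′ , there (here refl) , subst (WalkIn (G - F) S′ x′) (≡.sym (⁅⁆⁻ v≡x′)) (here x′∈S′))
  reach (inj₁ v∈Y)  = do
    no y≁v ← ¬¬-excluded-middle {A = WalkIn G (not ∘ side) y v}
      where yes W → pure (y , here refl , lift W)
    let w , Wvw , x′w = sees x′ sx′ x′≢x v (not-true⁻ v∈Y) y≁v
    pure (via Wvw x′w)

edgeCount-split : (G : Graph n) (side : Fin n → Bool) (F : BipSub G side) (x′ : Fin n)
  → edgeCount (adj (G [ side ])) + edgeCount (adj ((G - F) [ (not ∘ side) ∪ ⁅ x′ ⁆ ])) + edgeCount (fadj F)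
    ≤ edgeCount (adj G)
edgeCount-split {n} G side F x′ = begin
  edgeCount (adj (G [ side ])) + edgeCount (adj ((G - F) [ S′ ])) + edgeCount (fadj F)
    ≤⟨ +-monoˡ-≤ (edgeCount (fadj F)) (edgeCount-+-≤ X-H-disjoint X⊆G-F H⊆G-F) ⟩
  edgeCount (adj (G - F)) + edgeCount (fadj F)
    ≤⟨ edgeCount-+-≤ G-F-F-disjoint (λ i j → proj₁ ∘ ∧-true⁻) (fsub F) ⟩
  edgeCount (adj G) ∎
  where
  open ≤-Reasoning
  S′ : Fin n → Bool
  S′ = (not ∘ side) ∪ ⁅ x′ ⁆
  X∩S′ : ∀ {i} → side i ≡ true → S′ i ≡ true → i ≡ x′
  X∩S′ Xi S′i with ∨-true⁻ S′i
  ... | inj₁ Yi   = ⊥-elim (true≢false Xi (not-true⁻ Yi))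
  ... | inj₂ i≡x′ = ⁅⁆⁻ i≡x′
  X-H-disjoint : ∀ i j → adj (G [ side ]) i j ≡ true → adj ((G - F) [ S′ ]) i j ≡ true → ⊥
  X-H-disjoint i j Xij Hij with induced⁻ {G = G} {side} Xij | induced⁻ {G = G - F} {S′} Hij
  ... | Xi , Xj , Gij | S′i , S′j , _ with X∩S′ Xi S′i | X∩S′ Xj S′j
  ... | refl | refl = true≢false Gij (irrefl G x′)
  X⊆G-F : ∀ i j → adj (G [ side ]) i j ≡ true → adj (G - F) i j ≡ true
  X⊆G-F i j Xij with induced⁻ {G = G} {side} Xij
  ... | Xi , Xj , Gij = ∧-true⁺ Gij (not-true⁺ (fadj-same-side F (trans Xi (≡.sym Xj))))
  H⊆G-F : ∀ i j → adj ((G - F) [ S′ ]) i j ≡ true → adj (G - F) i j ≡ true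
  H⊆G-F i j = proj₂ ∘ proj₂ ∘ induced⁻ {G = G - F} {S′}
  G-F-F-disjoint : ∀ i j → adj (G - F) i j ≡ true → fadj F i j ≡ true → ⊥
  G-F-F-disjoint i j G-Fij Fij = true≢false Fij (not-true⁻ (proj₂ (∧-true⁻ G-Fij)))

forests-arith : ∀ {n a b p q r} → a + b ≡ n → a ≤ p + 4 → suc b ≤ q + 3 → n ∸ 1 ≤ r
  → 2 * n ∸ 7 ≤ p + q + r
forests-arith {n} {a} {b} {p} {q} {r} a+b≡n a≤p+4 b<q+3 n∸1≤r = m≤n+o⇒m∸n≤o (2 * n) 7 (begin
  2 * n                  ≡⟨ double n ⟩
  n + n                  ≤⟨ +-mono-≤ (≤-reflexive (≡.sym a+b≡n)) (m≤n+m∸n n 1) ⟩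
  a + b + (1 + (n ∸ 1))  ≡⟨ shift a b (n ∸ 1) ⟩
  a + suc b + (n ∸ 1)    ≤⟨ +-mono-≤ (+-mono-≤ a≤p+4 b<q+3) n∸1≤r ⟩
  p + 4 + (q + 3) + r    ≡⟨ collect p q r ⟩
  7 + (p + q + r)        ∎)
  where
  open ≤-Reasoning
  double : ∀ m → 2 * m ≡ m + m
  double = solve-∀
  shift : ∀ a b m → a + b + (1 + m) ≡ a + suc b + m
  shift = solve-∀
  collect : ∀ p q r → p + 4 + (q + 3) + r ≡ 7 + (p + q + r)
  collect = solve-∀

components-arith : ∀ {n a b c e} → a + b ≡ n → a ≤ b → b ≡ suc c → 4 * c ≤ e → 2 * n ∸ 7 ≤ e
components-arith {n} {a} {b} {c} {e} a+b≡n a≤b b≡1+c 4c≤e = m≤n+o⇒m∸n≤o (2 * n) 7 (begin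
  2 * n                ≡⟨ cong (2 *_) (≡.sym a+b≡n) ⟩
  2 * (a + b)          ≤⟨ *-monoʳ-≤ 2 (+-monoˡ-≤ b a≤b) ⟩
  2 * (b + b)          ≡⟨ cong (λ m → 2 * (m + m)) b≡1+c ⟩
  2 * (suc c + suc c)  ≡⟨ double-suc c ⟩
  4 + 4 * c            ≤⟨ +-mono-≤ (m≤m+n 4 3) 4c≤e ⟩
  7 + e                ∎)
  where
  open ≤-Reasoning
  double-suc : ∀ c → 2 * (suc c + suc c) ≡ 4 + 4 * c
  double-suc = solve-∀

lemma2p2 : (n : ℕ) (G : Graph n) (side : Fin n → Bool)
    → 2 ≤ countF side
    → countF side ≤ countF (λ v → not (side v))
    → (x y : Fin n) → side x ≡ true → side y ≡ false
    → (∀ x' → side x' ≡ true → x' ≢ x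
         → ∀ v → side v ≡ false → ¬ WalkIn G (λ u → not (side u)) y v
         → ∃ λ w → WalkIn G (λ u → not (side u)) v w × adj G x' w ≡ true)
    → (∀ y' → side y' ≡ false → y' ≢ y
         → ∀ v → side v ≡ true → ¬ WalkIn G side x v
         → ∃ λ w → WalkIn G side v w × adj G y' w ≡ true)
    → (Σ (Fin n) λ x' → side x' ≡ true × x' ≢ x
         × Σ (BipSub G side) λ F → degree (fadj F) x' ≤ 1 × n ∸ 1 ≤ edgeCount (fadj F))
    → 2 * n ∸ 7 ≤ edgeCount (adj G)
lemma2p2 n G side _ |X|≤|Y| x y sx sy seesY seesX (x′ , sx′ , x′≢x , F , dF , eF) =
  decidable-stable (2 * n ∸ 7 ≤? edgeCount (adj G)) do
    inj₁ (vs , |vs|<4 , X-covered) ← cover-or-scatter G side sx 4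
      where inj₂ (vs , |vs|≡4 , X-scattered) → pure (components-arith |X|+|Y|≡n |X|≤|Y| |Y|≡1+|Y∖y|
              (subst (λ k → k * _ ≤ _) |vs|≡4 (scattered⇒edges≥ G side x y seesX X-scattered)))
    let y₀ , y₀-unique = countF≤1⇒⊆⁅⁆ (fadj F x′) x′ dF
    forestX ← spanning-forest G side (x ∷ vs) X-covered
    forestH ← spanning-forest (G - F) ((not ∘ side) ∪ ⁅ x′ ⁆) (y ∷ x′ ∷ y₀ ∷ [])
                (Y∪x′-covered G side x y seesY sx′ x′≢x F y₀-unique)
    pure (≤-trans
      (forests-arith |X|+|Y|≡n (≤-trans forestX (+-monoʳ-≤ _ |vs|<4))
        (≤-trans (≤-reflexive (≡.sym (countF-insert x′ (cong not sx′)))) forestH) eF)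
      (edgeCount-split G side F x′))
  where
  |X|+|Y|≡n : countF side + countF (not ∘ side) ≡ n
  |X|+|Y|≡n = countF-complement side
  |Y|≡1+|Y∖y| : countF (not ∘ side) ≡ suc (countF ((not ∘ side) ∖ ⁅ y ⁆))
  |Y|≡1+|Y∖y| = countF-remove (not ∘ side) (not-true⁺ sy)
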